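{- For all integers $n\ge 1$ and all even integers $\ell$ with $0\le \ell\le n$, we have $\mathbb{N}^\varphi(n,\ell)\le 3\ell+6$.
   Context: $\varphi$ denotes Euler's totient function. For a sequence $A=(a_1,a_2,a_3,\dots)$ of positive integers and an integer $n\ge 1$, the partial evaluations $A^\varphi(n,k)$ for $0\le k\le n$ are defined recursively by $A^\varphi(n,n)=0$ and $A^\varphi(n,k-1)=\varphi\big(a_k+A^\varphi(n,k)\big)$ for $1\le k\le n$. Here $\mathbb{N}^\varphi(n,k)$ denotes this with $A$ the sequence of positive integers, $a_j=j$. -}

module Defs where

open import Data.Nat using (ℕ; zero; suc; _+_; _∸_)
open import Data.Nat.GCD using (gcd)
open import Data.List using (List; length; filter; upTo; map)
open import Relation.Binary.PropositionalEquality using (_≡_)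
open import Data.Nat using (_≟_)

-- Euler's totient: φ m = #{ k : 1 ≤ k ≤ m , gcd k m = 1 }  (so φ 0 = 0, φ 1 = 1)
φ : ℕ → ℕ
φ m = length (filter (λ k → gcd k m ≟ 1) (map suc (upTo m)))

-- evalFrom j k : the value A^φ(k + j, k) for the sequence a_i = i,
-- computed by recursion on the number j = n - k of remaining terms:
--   evalFrom 0 k = 0,   evalFrom (suc j) k = φ (a_{k+1} + evalFrom j (k+1)).
evalFrom : ℕ → ℕ → ℕ
evalFrom zero    k = 0
evalFrom (suc j) k = φ (suc k + evalFrom j (suc k))

Nφ : ℕ → ℕ → ℕ
Nφ n k = evalFrom (n ∸ k) k

{-# OPTIONS --safe #-}
-- For even k write x = ℕ^φ(n, k+2). If x ≤ 3(k+2)+6, then 2+k+x is even, so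
-- φ(2+k+x) ≤ (2+k+x)/2 ≤ 2k+7; since φ(m) is even for m ≥ 3, in fact
-- φ(2+k+x) ≤ 2k+6, and then φ(k+1+φ(2+k+x)) ≤ k+2k+6 because φ(m) < m for m ≥ 2.
-- Induction in steps of two does the rest. The three totient facts come from
-- writing φ(m) as a sum of coprimality indicators: φ(2h) ≤ h because even
-- residues are not coprime to 2h, and φ(m) is even because the indicator is
-- palindromic on [0, m], by gcd(m−k, m) = gcd(k, m).
module Submission where

open import Defs
open import Data.Nat
  using (ℕ; zero; suc; _+_; _*_; _∸_; _≤_; _<_; _⊔_; z≤n; s≤s; z<s; s<s; s≤s⁻¹; _≟_)
open import Data.Nat.Properties
open import Data.Nat.Divisibility
  using ( _∣_; divides; divides-refl; _∣0; ∣-refl; ∣-antisym; ∣1⇒≡1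
        ; ∣m∣n⇒∣m+n; ∣m+n∣m⇒∣n; n∣m*n; m∣m*n)
open import Data.Nat.GCD using (gcd; gcd[m,n]∣m; gcd[m,n]∣n; gcd-greatest)
open import Data.Nat.Tactic.RingSolver using (solve-∀)
open import Algebra.Properties.CommutativeSemigroup +-commutativeSemigroup using (interchange)
open import Data.List using (length; filter; applyUpTo)
open import Data.List.Properties using (map-upTo)
open import Data.Product using (∃-syntax; _,_)
open import Data.Sum using (_⊎_; inj₁; inj₂)
open import Function using (_∘_)
open import Relation.Nullary using (Dec; yes; no; ¬_; contradiction)
open import Relation.Unary using (Pred; Decidable)
open import Relation.Binary.PropositionalEquality
  using (_≡_; refl; sym; trans; cong; cong₂; subst; module ≡-Reasoning)

∑ : ℕ → (ℕ → ℕ) → ℕ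
∑ zero    f = 0
∑ (suc n) f = f 0 + ∑ n (f ∘ suc)

∑-cong : ∀ n {f g} → (∀ {k} → k < n → f k ≡ g k) → ∑ n f ≡ ∑ n g
∑-cong zero    f≡g = refl
∑-cong (suc n) f≡g = cong₂ _+_ (f≡g z<s) (∑-cong n (f≡g ∘ s<s))

∑-suc : ∀ n f → ∑ (suc n) f ≡ ∑ n f + f n
∑-suc zero    f = +-comm (f 0) 0
∑-suc (suc n) f = trans (cong (f 0 +_) (∑-suc n (f ∘ suc))) (sym (+-assoc (f 0) _ _))

∑-+ : ∀ m n f → ∑ (m + n) f ≡ ∑ m f + ∑ n (λ k → f (m + k))
∑-+ zero    n f = refl
∑-+ (suc m) n f = trans (cong (f 0 +_) (∑-+ m n (f ∘ suc))) (sym (+-assoc (f 0) _ _))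

∑-reverse : ∀ n f → ∑ n f ≡ ∑ n (λ k → f (n ∸ suc k))
∑-reverse zero    f = refl
∑-reverse (suc n) f = begin
  ∑ (suc n) f                      ≡⟨ ∑-suc n f ⟩
  ∑ n f + f n                      ≡⟨ +-comm (∑ n f) (f n) ⟩
  f n + ∑ n f                      ≡⟨ cong (f n +_) (∑-reverse n f) ⟩
  f n + ∑ n (λ k → f (n ∸ suc k))  ∎
  where open ≡-Reasoning

∑-*2 : ∀ h f → ∑ (h * 2) f ≡ ∑ h (λ i → f (i * 2)) + ∑ h (λ i → f (suc (i * 2)))
∑-*2 zero    f = refl
∑-*2 (suc h) f = begin
  f 0 + (f 1 + ∑ (h * 2) (f ∘ suc ∘ suc))  ≡⟨ cong (λ s → f 0 + (f 1 + s)) (∑-*2 h _) ⟩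
  f 0 + (f 1 + (E + O))                    ≡⟨ sym (+-assoc (f 0) (f 1) (E + O)) ⟩
  f 0 + f 1 + (E + O)                      ≡⟨ interchange (f 0) (f 1) E O ⟩
  f 0 + E + (f 1 + O)                      ∎
  where
  open ≡-Reasoning
  E = ∑ h (λ i → f (suc (suc (i * 2))))
  O = ∑ h (λ i → f (suc (suc (suc (i * 2)))))

∑-≤ : ∀ n {f b} → (∀ k → f k ≤ b) → ∑ n f ≤ n * b
∑-≤ zero    f≤b = z≤n
∑-≤ (suc n) f≤b = +-mono-≤ (f≤b 0) (∑-≤ n (f≤b ∘ suc))

Palindromic : ℕ → (ℕ → ℕ) → Set
Palindromic n f = ∀ {k} → k < n → f (n ∸ suc k) ≡ f k

∑-palindromic-even : ∀ h {f} → Palindromic (h + h) f → ∑ (h + h) f ≡ ∑ h f + ∑ h f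
∑-palindromic-even h {f} pal = begin
  ∑ (h + h) f                              ≡⟨ ∑-+ h h f ⟩
  ∑ h f + ∑ h (λ k → f (h + k))            ≡⟨ cong (∑ h f +_) (∑-reverse h _) ⟩
  ∑ h f + ∑ h (λ k → f (h + (h ∸ suc k)))  ≡⟨ cong (∑ h f +_) (∑-cong h mirror) ⟩
  ∑ h f + ∑ h f                            ∎
  where
  open ≡-Reasoning
  mirror : ∀ {k} → k < h → f (h + (h ∸ suc k)) ≡ f k
  mirror k<h = trans (cong f (sym (+-∸-assoc h k<h))) (pal (m≤n⇒m≤o+n h k<h))

∑-palindromic-odd : ∀ h {f} → Palindromic (suc (h + h)) f →
                    ∑ (suc (h + h)) f ≡ f h + (∑ h f + ∑ h f)
∑-palindromic-odd h {f} pal = begin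
  ∑ (suc h + h) f                                    ≡⟨ ∑-+ (suc h) h f ⟩
  ∑ (suc h) f + ∑ h (λ k → f (suc h + k))            ≡⟨ cong₂ _+_ (∑-suc h f) (∑-reverse h _) ⟩
  ∑ h f + f h + ∑ h (λ k → f (suc h + (h ∸ suc k)))  ≡⟨ cong (∑ h f + f h +_) (∑-cong h mirror) ⟩
  ∑ h f + f h + ∑ h f                                ≡⟨ cong (_+ ∑ h f) (+-comm (∑ h f) (f h)) ⟩
  f h + ∑ h f + ∑ h f                                ≡⟨ +-assoc (f h) (∑ h f) (∑ h f) ⟩
  f h + (∑ h f + ∑ h f)                              ∎
  where
  open ≡-Reasoning
  mirror : ∀ {k} → k < h → f (suc h + (h ∸ suc k)) ≡ f k
  mirror k<h = trans (cong f (sym (+-∸-assoc (suc h) k<h))) (pal (m≤n⇒m≤o+n (suc h) k<h))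

even⊎odd : ∀ n → ∃[ h ] (n ≡ h + h ⊎ n ≡ suc (h + h))
even⊎odd zero = 0 , inj₁ refl
even⊎odd (suc n) with even⊎odd n
... | h , inj₁ refl = h , inj₂ refl
... | h , inj₂ refl = suc h , inj₁ (cong suc (sym (+-suc h h)))

2∣m+m : ∀ m → 2 ∣ m + m
2∣m+m m = divides m (trans (cong (m +_) (sym (+-identityʳ m))) (*-comm 2 m))

palindromic⇒2∣∑ : ∀ n {f} → Palindromic n f →
                   (∀ h → n ≡ suc (h + h) → 2 ∣ f h) → 2 ∣ ∑ n f
palindromic⇒2∣∑ n {f} pal 2∣middle with even⊎odd n
... | h , inj₁ refl = subst (2 ∣_) (sym (∑-palindromic-even h pal)) (2∣m+m (∑ h f))
... | h , inj₂ refl = subst (2 ∣_) (sym (∑-palindromic-odd h pal))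
                        (∣m∣n⇒∣m+n (2∣middle h refl) (2∣m+m (∑ h f)))

∣m∣n⇒∣m∸n : ∀ {d m n} → d ∣ m → d ∣ n → d ∣ m ∸ n
∣m∣n⇒∣m∸n {d} (divides-refl p) (divides-refl q) =
  divides (p ∸ q) (sym (*-distribʳ-∸ d p q))

gcd[m∸n,m]≡gcd[n,m] : ∀ {m n} → n ≤ m → gcd (m ∸ n) m ≡ gcd n m
gcd[m∸n,m]≡gcd[n,m] {m} {n} n≤m = ∣-antisym
  (gcd-greatest (subst (gcd (m ∸ n) m ∣_) (m∸[m∸n]≡n n≤m) (∣m∣n⇒∣m∸n g′∣m g′∣m∸n)) g′∣m)
  (gcd-greatest (∣m∣n⇒∣m∸n (gcd[m,n]∣n n m) (gcd[m,n]∣m n m)) (gcd[m,n]∣n n m))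
  where
  g′∣m∸n = gcd[m,n]∣m (m ∸ n) m
  g′∣m   = gcd[m,n]∣n (m ∸ n) m

𝟙 : ∀ {a} {A : Set a} → Dec A → ℕ
𝟙 (yes _) = 1
𝟙 (no _)  = 0

𝟙≤1 : ∀ {a} {A : Set a} (a? : Dec A) → 𝟙 a? ≤ 1
𝟙≤1 (yes _) = s≤s z≤n
𝟙≤1 (no _)  = z≤n

𝟙-no : ∀ {a} {A : Set a} (a? : Dec A) → ¬ A → 𝟙 a? ≡ 0
𝟙-no (yes a) ¬a = contradiction a ¬a
𝟙-no (no _)  ¬a = refl

length-filter-applyUpTo : ∀ {a p} {A : Set a} {P : Pred A p} (P? : Decidable P) f n →
                          length (filter P? (applyUpTo f n)) ≡ ∑ n (λ k → 𝟙 (P? (f k)))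
length-filter-applyUpTo P? f zero = refl
length-filter-applyUpTo P? f (suc n) with P? (f 0)
... | yes _ = cong suc (length-filter-applyUpTo P? (f ∘ suc) n)
... | no _  = length-filter-applyUpTo P? (f ∘ suc) n

χ : ℕ → ℕ → ℕ
χ m k = 𝟙 (gcd k m ≟ 1)

χ≤1 : ∀ m k → χ m k ≤ 1
χ≤1 m k = 𝟙≤1 (gcd k m ≟ 1)

χ≡0 : ∀ {d m k} → 1 < d → d ∣ k → d ∣ m → χ m k ≡ 0
χ≡0 {d} {m} {k} 1<d d∣k d∣m = 𝟙-no (gcd k m ≟ 1)
  λ gcd≡1 → >⇒≢ 1<d (∣1⇒≡1 (subst (d ∣_) gcd≡1 (gcd-greatest d∣k d∣m)))

χ-palindromic : ∀ m → Palindromic (suc m) (χ m)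
χ-palindromic m k<1+m = cong (λ g → 𝟙 (g ≟ 1)) (gcd[m∸n,m]≡gcd[n,m] (s≤s⁻¹ k<1+m))

φ≡∑ : ∀ m → φ m ≡ ∑ m (χ m ∘ suc)
φ≡∑ m = trans (cong (length ∘ filter (λ k → gcd k m ≟ 1)) (map-upTo suc m))
              (length-filter-applyUpTo (λ k → gcd k m ≟ 1) suc m)

φ≡∑₀ : ∀ {m} → 1 < m → φ m ≡ ∑ (suc m) (χ m)
φ≡∑₀ {m} 1<m = trans (φ≡∑ m) (cong (_+ ∑ m (χ m ∘ suc)) (sym (χ≡0 1<m (m ∣0) ∣-refl)))

φ[m]≤m : ∀ m → φ m ≤ m
φ[m]≤m m = begin
  φ m                ≡⟨ φ≡∑ m ⟩
  ∑ m (χ m ∘ suc)    ≤⟨ ∑-≤ m (χ≤1 m ∘ suc) ⟩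
  m * 1              ≡⟨ *-identityʳ m ⟩
  m                  ∎
  where open ≤-Reasoning

φ[1+n]≤n⊔1 : ∀ n → φ (suc n) ≤ n ⊔ 1
φ[1+n]≤n⊔1 zero    = φ[m]≤m 1
φ[1+n]≤n⊔1 (suc n) = ≤-trans φ[2+n]≤1+n (m≤m⊔n (suc n) 1)
  where
  open ≤-Reasoning
  m = suc (suc n)
  φ[2+n]≤1+n : φ m ≤ suc n
  φ[2+n]≤1+n = begin
    φ m                            ≡⟨ φ≡∑ m ⟩
    ∑ m (χ m ∘ suc)                ≡⟨ ∑-suc (suc n) (χ m ∘ suc) ⟩
    ∑ (suc n) (χ m ∘ suc) + χ m m  ≡⟨ cong (∑ (suc n) (χ m ∘ suc) +_) (χ≡0 {m} (s<s z<s) ∣-refl ∣-refl) ⟩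
    ∑ (suc n) (χ m ∘ suc) + 0      ≡⟨ +-identityʳ _ ⟩
    ∑ (suc n) (χ m ∘ suc)          ≤⟨ ∑-≤ (suc n) (χ≤1 m ∘ suc) ⟩
    suc n * 1                      ≡⟨ *-identityʳ (suc n) ⟩
    suc n                          ∎

φ[h*2]≤h : ∀ h → φ (h * 2) ≤ h
φ[h*2]≤h h = begin
  φ m                                                            ≡⟨ φ≡∑ m ⟩
  ∑ m (χ m ∘ suc)                                                ≡⟨ ∑-*2 h (χ m ∘ suc) ⟩
  ∑ h (λ i → χ m (suc (i * 2))) + ∑ h (λ i → χ m (suc i * 2))  ≤⟨ +-mono-≤ odd-terms even-terms ⟩
  h * 1 + h * 0                                                  ≡⟨ cong₂ _+_ (*-identityʳ h) (*-zeroʳ h) ⟩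
  h + 0                                                          ≡⟨ +-identityʳ h ⟩
  h                                                              ∎
  where
  open ≤-Reasoning
  m = h * 2
  odd-terms : ∑ h (λ i → χ m (suc (i * 2))) ≤ h * 1
  odd-terms = ∑-≤ h (λ i → χ≤1 m (suc (i * 2)))
  even-terms : ∑ h (λ i → χ m (suc i * 2)) ≤ h * 0
  even-terms = ∑-≤ h (λ i → ≤-reflexive (χ≡0 (s<s z<s) (n∣m*n (suc i)) (n∣m*n h)))

φ-even : ∀ {m} → 2 < m → 2 ∣ φ m
φ-even {m} 2<m =
  subst (2 ∣_) (sym (φ≡∑₀ (<⇒≤ 2<m))) (palindromic⇒2∣∑ (suc m) (χ-palindromic m) 2∣middle)
  where
  2∣middle : ∀ h → suc m ≡ suc (h + h) → 2 ∣ χ m h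
  2∣middle h 1+m≡1+h+h = subst (2 ∣_) (sym (χ≡0 1<h ∣-refl h∣m)) (2 ∣0)
    where
    m≡h+h = suc-injective 1+m≡1+h+h
    h∣m : h ∣ m
    h∣m = subst (h ∣_) (sym m≡h+h) (∣m∣n⇒∣m+n ∣-refl ∣-refl)
    1<h : 1 < h
    1<h = ≰⇒> λ h≤1 → <⇒≱ 2<m (subst (_≤ 2) (sym m≡h+h) (+-mono-≤ h≤1 h≤1))

∣-≤-suc⇒≤ : ∀ {d m n} → 1 < d → d ∣ m → d ∣ n → m ≤ suc n → m ≤ n
∣-≤-suc⇒≤ {d} {m} {n} 1<d d∣m d∣n m≤1+n with m≤n⇒m<n∨m≡n m≤1+n
... | inj₁ m<1+n = s≤s⁻¹ m<1+n
... | inj₂ refl  = contradiction (∣1⇒≡1 d∣1) (>⇒≢ 1<d)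
  where
  d∣1 : d ∣ 1
  d∣1 = ∣m+n∣m⇒∣n (subst (d ∣_) (+-comm 1 n) d∣m) d∣n

φ≤1+n⇒φ≤n : ∀ m {n} → 2 ∣ n → 2 ≤ n → φ m ≤ suc n → φ m ≤ n
φ≤1+n⇒φ≤n m 2∣n 2≤n φm≤1+n with ≤-<-connex m 2
... | inj₁ m≤2 = ≤-trans (φ[m]≤m m) (≤-trans m≤2 2≤n)
... | inj₂ 2<m = ∣-≤-suc⇒≤ (s<s z<s) (φ-even 2<m) 2∣n φm≤1+n

evalFrom-even : ∀ j {k} → 1 < k → 2 ∣ evalFrom j k
evalFrom-even zero        _   = 2 ∣0
evalFrom-even (suc j) {k} 1<k = φ-even (≤-trans (s≤s 1<k) (m≤m+n (suc k) (evalFrom j (suc k))))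

φ[2+k+x]≤2k+6 : ∀ {k x} → 2 ∣ k → 2 ∣ x → x ≤ 3 * (2 + k) + 6 → φ (2 + k + x) ≤ 2 * k + 6
φ[2+k+x]≤2k+6 {k} {x} 2∣k 2∣x x≤ =
  φ≤1+n⇒φ≤n (2 + k + x) 2∣2k+6 (m≤n⇒m≤o+n (2 * k) (s≤s (s≤s z≤n))) half-bound
  where
  2∣2k+6 : 2 ∣ 2 * k + 6
  2∣2k+6 = ∣m∣n⇒∣m+n (m∣m*n k) (divides 3 refl)

  half-bound : φ (2 + k + x) ≤ suc (2 * k + 6)
  half-bound with ∣m∣n⇒∣m+n (∣m∣n⇒∣m+n ∣-refl 2∣k) 2∣x
  ... | divides s m≡s*2 = begin
    φ (2 + k + x)   ≡⟨ cong φ m≡s*2 ⟩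
    φ (s * 2)       ≤⟨ φ[h*2]≤h s ⟩
    s               ≤⟨ *-cancelʳ-≤ s (suc (2 * k + 6)) 2 s*2≤ ⟩
    suc (2 * k + 6) ∎
    where
    open ≤-Reasoning
    identity : ∀ k → 2 + k + (3 * (2 + k) + 6) ≡ suc (2 * k + 6) * 2
    identity = solve-∀
    s*2≤ : s * 2 ≤ suc (2 * k + 6) * 2
    s*2≤ = subst (_≤ suc (2 * k + 6) * 2) m≡s*2 (≤-trans (+-monoʳ-≤ (2 + k) x≤) (≤-reflexive (identity k)))

φ[1+k+y]≤3k+6 : ∀ {k y} → y ≤ 2 * k + 6 → φ (suc k + y) ≤ 3 * k + 6
φ[1+k+y]≤3k+6 {k} {y} y≤ =
  ≤-trans (φ[1+n]≤n⊔1 (k + y)) (⊔-lub k+y≤ (m≤n⇒m≤o+n (3 * k) (s≤s z≤n)))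
  where
  identity : ∀ k → k + (2 * k + 6) ≡ 3 * k + 6
  identity = solve-∀
  k+y≤ : k + y ≤ 3 * k + 6
  k+y≤ = ≤-trans (+-monoʳ-≤ k y≤) (≤-reflexive (identity k))

evalFrom-bound : ∀ j {k} → 2 ∣ k → evalFrom j k ≤ 3 * k + 6
evalFrom-bound zero              _   = z≤n
evalFrom-bound (suc zero)    {k} _   = φ[1+k+y]≤3k+6 {k} z≤n
evalFrom-bound (suc (suc j)) {k} 2∣k = φ[1+k+y]≤3k+6 {k} (φ[2+k+x]≤2k+6 2∣k 2∣x x≤)
  where
  2∣x = evalFrom-even j (s<s z<s)
  x≤  = evalFrom-bound j (∣m∣n⇒∣m+n ∣-refl 2∣k)

-- The bound holds whatever the number n ∸ ℓ of remaining terms.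
corollary2p1p1 : (n ℓ : ℕ) → 1 ≤ n → 2 ∣ ℓ → ℓ ≤ n → Nφ n ℓ ≤ 3 * ℓ + 6
corollary2p1p1 n ℓ _ 2∣ℓ _ = evalFrom-bound (n ∸ ℓ) 2∣ℓ
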